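{- Let $r\geq k\geq 1$, $t\in\{2,3\}$, and let $\varphi$ be a $t$-critical $(r,k)$-colouring of $K_n$. If $t=2$ then $n\leq r$, and if $t=3$ then $n\leq r+\binom{r}{2}$. Moreover, if in $\varphi$ every vertex sees each colour of $[r]$, then $t=3$ and $n\leq\binom{r}{2}$.
   Context: For integers $r\geq k\geq 1$, an $(r,k)$-colouring of a graph $G$ is a function $\varphi:E(G)\to\binom{[r]}{k}$, assigning to each edge a set of exactly $k$ colours from $[r]=\{1,\dots,r\}$. A monochromatic component in colour $i$ is a connected component of the spanning subgraph of $G$ consisting of all edges $e$ with $i\in\varphi(e)$. $\mathrm{tc}(G,\varphi)$ is the minimum number of monochromatic components (equivalently, monochromatic trees; a single vertex counts) whose union covers $V(G)$. A vertex sees colour $i$ if it is incident to an edge $e$ with $i\in\varphi(e)$. The colouring $\varphi$ is $t$-critical if $\mathrm{tc}(G,\varphi)=t$ and for each vertex $v\in V(G)$, the set $V(G)\setminus\{v\}$ can be covered by $t-1$ monochromatic components of $(G,\varphi)$. -}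

module Defs where

open import Data.Nat using (ℕ; _<_; pred)
open import Data.Fin using (Fin)
open import Data.Fin.Subset using (Subset; _∈_; ∣_∣)
open import Data.Product using (Σ; ∃; _×_; proj₁; proj₂)
open import Relation.Binary.PropositionalEquality using (_≡_; _≢_)
open import Relation.Nullary using (¬_)
open import Data.Unit using (⊤)

-- The value φ u u is irrelevant (loops are not edges of K_n).
record Colouring (n r k : ℕ) : Set where
  field
    col   : Fin n → Fin n → Subset r
    sym   : ∀ u v → u ≢ v → col u v ≡ col v u
    size  : ∀ u v → u ≢ v → ∣ col u v ∣ ≡ k
open Colouring public

-- Reach φ i u v : v lies in the monochromatic component of colour i containing u
-- (a walk from u to v using edges whose colour set contains i).
data Reach {n r k : ℕ} (φ : Colouring n r k) (i : Fin r) : Fin n → Fin n → Set where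
  here : ∀ {u} → Reach φ i u u
  step : ∀ {u w v} → u ≢ w → i ∈ col φ u w → Reach φ i w v → Reach φ i u v

-- A monochromatic component is specified by a colour and a root vertex;
-- a family of m components covers S ⊆ V if each vertex of S lies in one of them.
CoverBy : {n r k : ℕ} → Colouring n r k → ℕ → (Fin n → Set) → Set
CoverBy {n} {r} φ m S =
  Σ (Fin m → Fin r × Fin n) λ f →
    ∀ v → S v → ∃ λ j → Reach φ (proj₁ (f j)) (proj₂ (f j)) v

AllV : {n : ℕ} → Fin n → Set
AllV _ = ⊤

TcEq : {n r k : ℕ} → Colouring n r k → ℕ → Set
TcEq φ t = CoverBy φ t AllV × (∀ m → m < t → ¬ CoverBy φ m AllV)

Critical : {n r k : ℕ} → Colouring n r k → ℕ → Set
Critical {n} φ t = TcEq φ t × (∀ (v : Fin n) → CoverBy φ (pred t) (λ u → u ≢ v))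

Sees : {n r k : ℕ} → Colouring n r k → Fin n → Fin r → Set
Sees φ v i = ∃ λ w → v ≢ w × i ∈ col φ v w

-- A t-critical colouring of K_n assigns to every vertex v a cover of K_n − v by t − 1 monochromatic
-- components, none of which contains v (else tc would drop). For t = 2 this component's colour
-- determines v: two vertices with punctured components of the same colour would force these
-- components to meet, putting a vertex inside its own punctured component, or n = 2, where a single
-- edge spans K_n. For t = 3 one attaches to v the colour pair of a punctured 2-cover, chosen
-- monochromatic whenever possible. Two vertices with the same pair again yield a 2-cover of K_n,
-- except in one crossed configuration, which produces a monochromatic punctured cover and so is
-- excluded by the choice. Hence n is at most the number of unordered pairs, with repetition, of
-- colours. Finally, if v sees colour a, the colour-a component of some neighbour of v contains v, so
-- no punctured cover at v consists of colour-a components only: when every vertex sees every colour,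
-- t = 2 is impossible and no monochromatic choice exists.
module Submission where

open import Defs
open import Data.Nat using (ℕ; suc; _≤_; _+_; _≤?_)
open import Data.Nat.Combinatorics using (_C_; nC1≡n; nCk+nC[k+1]≡[n+1]C[k+1])
import Data.Nat.Properties as ℕ
open import Data.Fin using (Fin; zero; suc; _≟_)
open import Data.Fin.Properties using (injective⇒≤; sequence)
open import Data.Fin.Subset using (∣_∣; Nonempty) renaming (⊥ to ∅; _∈_ to _∈ₛ_)
open import Data.Fin.Subset.Properties using (nonempty?; Empty-unique; ∣⊥∣≡0)
open import Data.Vec.Functional using (_∷_)
open import Data.Product using (Σ-syntax; ∃; _×_; _,_; proj₁; proj₂)
import Data.Product as Product
open import Data.Sum using (_⊎_; inj₁; inj₂) renaming (map to ⊎-map; map₂ to ⊎-map₂; swap to ⊎-swap)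
open import Data.Empty using (⊥; ⊥-elim)
open import Data.List using (List; []; _++_; map; length; lookup; allFin)
open import Data.List.Properties using (length-++; length-map; length-tabulate)
open import Data.List.Membership.Propositional using () renaming (_∈_ to _∈ₗ_)
open import Data.List.Membership.Propositional.Properties using (∈-map⁺; ∈-allFin)
open import Data.List.Relation.Binary.Subset.Propositional using (_⊆_)
open import Data.List.Relation.Binary.Subset.Propositional.Properties using (xs⊆ys++xs; xs⊆xs++ys)
open import Data.List.Relation.Unary.Any using (index)
open import Data.List.Relation.Unary.Any.Properties using (lookup-index)
open import Effect.Monad using (RawMonad)
open import Function using (_∘_)
open import Function.Definitions using (Injective)
open import Relation.Nullary using (¬_; Dec; yes; no)
open import Relation.Nullary.Decidable using (decidable-stable; ¬¬-excluded-middle)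
open import Relation.Nullary.Negation using (¬¬-Monad; ¬¬-map)
open import Relation.Binary.PropositionalEquality
  using (_≡_; _≢_; refl; trans; cong; cong₂; subst; module ≡-Reasoning)
  renaming (sym to ≡-sym)

injection⇒≤length : ∀ {n} {A : Set} (L : List A) (g : Fin n → A) →
                    (∀ v → g v ∈ₗ L) → Injective _≡_ _≡_ g → n ≤ length L
injection⇒≤length L g g∈L g-injective = injective⇒≤ {f = index ∘ g∈L} λ {u} {v} index-eq →
  g-injective (trans (lookup-index (g∈L u))
                (trans (cong (lookup L) index-eq) (≡-sym (lookup-index (g∈L v)))))

ascendingPairs : (r : ℕ) → List (Fin r × Fin r)
ascendingPairs ℕ.zero = []
ascendingPairs (suc r) =
  map (λ b → zero , suc b) (allFin r) ++ map (Product.map suc suc) (ascendingPairs r)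

ascendingPairs-complete : ∀ {r} (a b : Fin r) → a ≢ b →
                          (a , b) ∈ₗ ascendingPairs r ⊎ (b , a) ∈ₗ ascendingPairs r
ascendingPairs-complete zero zero a≢b = ⊥-elim (a≢b refl)
ascendingPairs-complete {suc r} zero (suc b) _ =
  inj₁ (xs⊆xs++ys _ _ (∈-map⁺ (λ b → zero , suc b) (∈-allFin b)))
ascendingPairs-complete {suc r} (suc a) zero _ =
  inj₂ (xs⊆xs++ys _ _ (∈-map⁺ (λ b → zero , suc b) (∈-allFin a)))
ascendingPairs-complete {suc r} (suc a) (suc b) a≢b =
  ⊎-map shift shift (ascendingPairs-complete a b (a≢b ∘ cong suc))
  where
  shift : ∀ {p} → p ∈ₗ ascendingPairs r → Product.map suc suc p ∈ₗ ascendingPairs (suc r)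
  shift p∈ = xs⊆ys++xs _ _ (∈-map⁺ (Product.map suc suc) p∈)

length-allFin : ∀ r → length (allFin r) ≡ r
length-allFin r = length-tabulate (λ i → i)

length-ascendingPairs : ∀ r → length (ascendingPairs r) ≡ r C 2
length-ascendingPairs ℕ.zero = refl
length-ascendingPairs (suc r) = begin
  length (map (λ b → zero , suc b) (allFin r) ++ map (Product.map suc suc) (ascendingPairs r))
    ≡⟨ length-++ (map (λ b → zero , suc b) (allFin r)) ⟩
  length (map (λ b → zero , suc b) (allFin r)) + length (map (Product.map suc suc) (ascendingPairs r))
    ≡⟨ cong₂ _+_ (length-map _ (allFin r)) (length-map _ (ascendingPairs r)) ⟩
  length (allFin r) + length (ascendingPairs r)
    ≡⟨ cong₂ _+_ (trans (length-allFin r) (≡-sym (nC1≡n r))) (length-ascendingPairs r) ⟩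
  r C 1 + r C 2
    ≡⟨ nCk+nC[k+1]≡[n+1]C[k+1] r 1 ⟩
  suc r C 2 ∎
  where open ≡-Reasoning

diagonal : (r : ℕ) → List (Fin r × Fin r)
diagonal r = map (λ a → a , a) (allFin r)

colourPairs : (r : ℕ) → List (Fin r × Fin r)
colourPairs r = diagonal r ++ ascendingPairs r

length-colourPairs : ∀ r → length (colourPairs r) ≡ r + r C 2
length-colourPairs r = trans (length-++ (diagonal r))
  (cong₂ _+_ (trans (length-map _ (allFin r)) (length-allFin r)) (length-ascendingPairs r))

module Components {n r k : ℕ} (φ : Colouring n r k) where

  Reach-trans : ∀ {i u w v} → Reach φ i u w → Reach φ i w v → Reach φ i u v
  Reach-trans here       w↝v = w↝v
  Reach-trans (step u≢x i∈ux x↝w) w↝v = step u≢x i∈ux (Reach-trans x↝w w↝v)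

  Reach-edge : ∀ {i u v} → u ≢ v → i ∈ₛ col φ u v → Reach φ i u v
  Reach-edge u≢v i∈uv = step u≢v i∈uv here

  Reach-sym : ∀ {i u v} → Reach φ i u v → Reach φ i v u
  Reach-sym here = here
  Reach-sym {i} {u} (step {w = x} u≢x i∈ux x↝v) =
    Reach-trans (Reach-sym x↝v)
      (Reach-edge (u≢x ∘ ≡-sym) (subst (i ∈ₛ_) (Colouring.sym φ u x u≢x) i∈ux))

  Reach-shared : ∀ {i x y w z} → Reach φ i x w → Reach φ i y w → Reach φ i x z → Reach φ i y z
  Reach-shared x↝w y↝w x↝z = Reach-trans y↝w (Reach-trans (Reach-sym x↝w) x↝z)

  edge-colour : 1 ≤ k → ∀ {u v} → u ≢ v → Nonempty (col φ u v)
  edge-colour k≥1 {u} {v} u≢v with nonempty? (col φ u v)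
  ... | yes nonempty = nonempty
  ... | no empty = ⊥-elim (ℕ.<⇒≢ k≥1 (≡-sym (begin
        k                    ≡⟨ ≡-sym (Colouring.size φ u v u≢v) ⟩
        ∣ col φ u v ∣        ≡⟨ cong ∣_∣ (Empty-unique empty) ⟩
        ∣ ∅ {r} ∣            ≡⟨ ∣⊥∣≡0 r ⟩
        0                    ∎)))
    where open ≡-Reasoning

  Sees⇒neighbour : ∀ {v i} → Sees φ v i → ∃ λ w → w ≢ v × Reach φ i w v
  Sees⇒neighbour {v} (w , v≢w , i∈vw) = w , v≢w ∘ ≡-sym , Reach-sym (Reach-edge v≢w i∈vw)

  _∋_ : Fin r × Fin n → Fin n → Set
  K ∋ w = Reach φ (proj₁ K) (proj₂ K) w

  coverBy-∅ : CoverBy φ 0 (λ _ → ⊥)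
  coverBy-∅ = (λ ()) , λ _ ()

  coverBy-∷ : ∀ {m P} K → CoverBy φ m P → CoverBy φ (suc m) (λ w → K ∋ w ⊎ P w)
  coverBy-∷ K (f , covers) = K ∷ f , λ where
    w (inj₁ K∋w) → zero , K∋w
    w (inj₂ Pw)  → let j , fj∋w = covers w Pw in suc j , fj∋w

  coverBy-mono : ∀ {m} {P Q : Fin n → Set} → (∀ w → Q w → P w) → CoverBy φ m P → CoverBy φ m Q
  coverBy-mono Q⊆P (f , covers) = f , λ w → covers w ∘ Q⊆P w

  component-coverBy : ∀ {K P} → (∀ w → P w → K ∋ w) → CoverBy φ 1 P
  component-coverBy {K} covers = coverBy-mono (λ w → inj₁ ∘ covers w) (coverBy-∷ K coverBy-∅)

  punctured-cover-misses : ∀ {m v} → ¬ CoverBy φ m AllV →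
                           (c : CoverBy φ m (_≢ v)) → ∀ j → ¬ proj₁ c j ∋ v
  punctured-cover-misses {v = v} ¬cover (f , covers) j fj∋v = ¬cover (f , λ w _ → cover w)
    where
    cover : ∀ w → ∃ λ i → f i ∋ w
    cover w with w ≟ v
    ... | yes refl = j , fj∋v
    ... | no w≢v   = covers w w≢v

  edge-cover : 1 ≤ k → ∀ {m u v} → u ≢ v →
               CoverBy φ m (λ w → w ≢ u × w ≢ v) → CoverBy φ (suc m) AllV
  edge-cover k≥1 {u = u} {v} u≢v cover with edge-colour k≥1 u≢v
  ... | i , i∈uv = coverBy-mono classify (coverBy-∷ (i , u) cover)
    where
    classify : ∀ w → AllV w → (i , u) ∋ w ⊎ (w ≢ u × w ≢ v)
    classify w _ with w ≟ u | w ≟ v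
    ... | yes refl | _        = inj₁ here
    ... | no _     | yes refl = inj₁ (Reach-edge u≢v i∈uv)
    ... | no w≢u   | no w≢v   = inj₂ (w≢u , w≢v)

  Covers₂ : Fin r × Fin n → Fin r × Fin n → (Fin n → Set) → Set
  Covers₂ K K′ P = ∀ w → P w → K ∋ w ⊎ K′ ∋ w

  covers₂-swap : ∀ {K K′ P} → Covers₂ K K′ P → Covers₂ K′ K P
  covers₂-swap c w = ⊎-swap ∘ c w

  covers₂⇒coverBy : ∀ {K K′ P} → Covers₂ K K′ P → CoverBy φ 2 P
  covers₂⇒coverBy {K} {K′} c =
    coverBy-mono (λ w → ⊎-map₂ inj₁ ∘ c w) (coverBy-∷ K (coverBy-∷ K′ coverBy-∅))

  coverBy⇒covers₂ : ∀ {P} (c : CoverBy φ 2 P) → Covers₂ (proj₁ c zero) (proj₁ c (suc zero)) P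
  coverBy⇒covers₂ (f , covers) w Pw with covers w Pw
  ... | zero , f₀∋w     = inj₁ f₀∋w
  ... | suc zero , f₁∋w = inj₂ f₁∋w

  PuncturedMonoCover : Fin n → Set
  PuncturedMonoCover v = Σ[ a ∈ Fin r ] Σ[ x ∈ Fin n ] Σ[ y ∈ Fin n ] Covers₂ (a , x) (a , y) (_≢ v)

  record Labelled (L : List (Fin r × Fin r)) (v : Fin n) : Set where
    constructor labelled
    field
      a b       : Fin r
      x y       : Fin n
      covers    : Covers₂ (a , x) (b , y) (_≢ v)
      canonical : a ≡ b ⊎ ¬ PuncturedMonoCover v
      listed    : (a , b) ∈ₗ L

  relabel : ∀ {L L′ v} → L ⊆ L′ → Labelled L v → Labelled L′ v
  relabel L⊆L′ (labelled a b x y covers canonical listed) =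
    labelled a b x y covers canonical (L⊆L′ listed)

  label-mono : ∀ {v} → PuncturedMonoCover v → Labelled (colourPairs r) v
  label-mono (a , x , y , covers) =
    labelled a a x y covers (inj₁ refl) (xs⊆xs++ys _ _ (∈-map⁺ (λ a → a , a) (∈-allFin a)))

  label-non-mono : ∀ {a b x y v} → ¬ PuncturedMonoCover v → Covers₂ (a , x) (b , y) (_≢ v) →
                   Labelled (ascendingPairs r) v
  label-non-mono {a} {b} {x} {y} ¬mono covers with a ≟ b
  ... | yes refl = ⊥-elim (¬mono (a , x , y , covers))
  ... | no a≢b with ascendingPairs-complete a b a≢b
  ...   | inj₁ ab∈ = labelled a b x y covers (inj₂ ¬mono) ab∈
  ...   | inj₂ ba∈ = labelled b a y x (covers₂-swap covers) (inj₂ ¬mono) ba∈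

  punctured-colours-differ : 1 ≤ k → ¬ CoverBy φ 1 AllV → ∀ {a b x y u v} → u ≢ v →
                             (∀ w → w ≢ u → (a , x) ∋ w) → ¬ (a , x) ∋ u →
                             (∀ w → w ≢ v → (b , y) ∋ w) → a ≢ b
  punctured-colours-differ k≥1 ¬cover {u = u} {v} u≢v covers-u x∌u covers-v refl =
    ¬cover (edge-cover k≥1 u≢v (coverBy-mono only-u-v coverBy-∅))
    where
    only-u-v : ∀ w → w ≢ u × w ≢ v → ⊥
    only-u-v w (w≢u , w≢v) = x∌u (Reach-shared (covers-v w w≢v) (covers-u w w≢u) (covers-v u u≢v))

  module _ (k≥1 : 1 ≤ k) (no-2-cover : ¬ CoverBy φ 2 AllV) where

    first-misses : ∀ {K K′ v} → Covers₂ K K′ (_≢ v) → ¬ K ∋ v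
    first-misses covers = punctured-cover-misses no-2-cover (covers₂⇒coverBy covers) zero

    second-misses : ∀ {K K′ v} → Covers₂ K K′ (_≢ v) → ¬ K′ ∋ v
    second-misses = first-misses ∘ covers₂-swap

    second-component-forced : ∀ {a x z u w K′} → Covers₂ (a , x) K′ (_≢ u) → w ≢ u →
                              (a , z) ∋ w → (a , z) ∋ u → K′ ∋ w
    second-component-forced cu w≢u z∋w z∋u with cu _ w≢u
    ... | inj₁ x∋w  = ⊥-elim (first-misses cu (Reach-shared z∋w x∋w z∋u))
    ... | inj₂ K′∋w = K′∋w

    other-component-covers : ∀ {a p q p′ q′ u v} →
      Covers₂ (a , p′) (a , q′) (_≢ u) → Covers₂ (a , p) (a , q) (_≢ v) → (a , p) ∋ u →
      ∀ w → w ≢ u × w ≢ v → (a , q) ∋ w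
    other-component-covers cu cv p∋u w (w≢u , w≢v) with cv w w≢v
    ... | inj₂ q∋w = q∋w
    ... | inj₁ p∋w =
      ⊥-elim (second-misses cu (Reach-shared p∋w (second-component-forced cu w≢u p∋w p∋u) p∋u))

    monochromatic-collision : ∀ {a p q p′ q′ u v} → u ≢ v →
      Covers₂ (a , p′) (a , q′) (_≢ u) → Covers₂ (a , p) (a , q) (_≢ v) → ⊥
    monochromatic-collision u≢v cu cv with cv _ u≢v
    ... | inj₁ p∋u = no-2-cover (edge-cover k≥1 u≢v
                       (component-coverBy (other-component-covers cu cv p∋u)))
    ... | inj₂ q∋u = no-2-cover (edge-cover k≥1 u≢v
                       (component-coverBy (other-component-covers cu (covers₂-swap cv) q∋u)))

    parallel-collision : ∀ {a b xu yu xv yv u v} → u ≢ v →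
      Covers₂ (a , xu) (b , yu) (_≢ u) → Covers₂ (a , xv) (b , yv) (_≢ v) →
      (a , xv) ∋ u → (a , xu) ∋ v → ⊥
    parallel-collision {a} {b} {xu} {yu} {xv} {yv} {u} {v} u≢v cu cv xv∋u xu∋v =
      ¬¬-excluded-middle λ where
        (yes yu∋yv) → no-2-cover (edge-cover k≥1 u≢v (component-coverBy (yu-covers yu∋yv)))
        (no yu∌yv)  → no-2-cover (covers₂⇒coverBy (xv-xu-cover yu∌yv))
      where
      yu-covers : (b , yu) ∋ yv → ∀ w → w ≢ u × w ≢ v → (b , yu) ∋ w
      yu-covers yu∋yv w (w≢u , w≢v) with cv w w≢v
      ... | inj₁ xv∋w = second-component-forced cu w≢u xv∋w xv∋u
      ... | inj₂ yv∋w = Reach-trans yu∋yv yv∋w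

      xv-xu-cover : ¬ (b , yu) ∋ yv → Covers₂ (a , xv) (a , xu) AllV
      xv-xu-cover yu∌yv w _ with w ≟ u | w ≟ v
      ... | yes refl | _        = inj₁ xv∋u
      ... | no _     | yes refl = inj₂ xu∋v
      ... | no w≢u   | no w≢v   with cv w w≢v | cu w w≢u
      ...   | inj₁ xv∋w | _         = inj₁ xv∋w
      ...   | inj₂ _    | inj₁ xu∋w = inj₂ xu∋w
      ...   | inj₂ yv∋w | inj₂ yu∋w = ⊥-elim (yu∌yv (Reach-trans yu∋w (Reach-sym yv∋w)))

    crossed-mono-cover : ∀ {a b xu yu xv yv u v} → u ≢ v →
      Covers₂ (a , xu) (b , yu) (_≢ u) → Covers₂ (a , xv) (b , yv) (_≢ v) →
      (a , xv) ∋ u → (b , yu) ∋ v → Covers₂ (a , xv) (a , xu) (_≢ v)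
    crossed-mono-cover {u = u} u≢v cu cv xv∋u yu∋v w w≢v with w ≟ u
    ... | yes refl = inj₁ xv∋u
    ... | no w≢u with cu w w≢u
    ...   | inj₁ xu∋w = inj₂ xu∋w
    ...   | inj₂ yu∋w = inj₁ (second-component-forced (covers₂-swap cv) w≢v yu∋w yu∋v)

    same-colours-collide : ∀ {a b xu yu xv yv u v} → u ≢ v →
      Covers₂ (a , xu) (b , yu) (_≢ u) → Covers₂ (a , xv) (b , yv) (_≢ v) →
      a ≡ b ⊎ ¬ PuncturedMonoCover u → a ≡ b ⊎ ¬ PuncturedMonoCover v → ⊥
    same-colours-collide u≢v cu cv (inj₁ refl) _          = monochromatic-collision u≢v cu cv
    same-colours-collide u≢v cu cv (inj₂ _)    (inj₁ refl) = monochromatic-collision u≢v cu cv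
    same-colours-collide u≢v cu cv (inj₂ ¬mono-u) (inj₂ ¬mono-v)
      with cv _ u≢v | cu _ (u≢v ∘ ≡-sym)
    ... | inj₁ xv∋u | inj₁ xu∋v = parallel-collision u≢v cu cv xv∋u xu∋v
    ... | inj₂ yv∋u | inj₂ yu∋v =
      parallel-collision u≢v (covers₂-swap cu) (covers₂-swap cv) yv∋u yu∋v
    ... | inj₁ xv∋u | inj₂ yu∋v = ¬mono-v (_ , _ , _ , crossed-mono-cover u≢v cu cv xv∋u yu∋v)
    ... | inj₂ yv∋u | inj₁ xu∋v =
      ¬mono-u (_ , _ , _ , crossed-mono-cover (u≢v ∘ ≡-sym) cv cu xu∋v yv∋u)

    labelled-count : ∀ {L} → (∀ v → Labelled L v) → n ≤ length L
    labelled-count {L} ℓ = injection⇒≤length L key (Labelled.listed ∘ ℓ) key-injective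
      where
      key : Fin n → Fin r × Fin r
      key v = Labelled.a (ℓ v) , Labelled.b (ℓ v)

      key-injective : Injective _≡_ _≡_ key
      key-injective {u} {v} same-key with u ≟ v
      ... | yes u≡v = u≡v
      ... | no u≢v  = ⊥-elim (collide (ℓ u) (ℓ v) (cong proj₁ same-key) (cong proj₂ same-key))
        where
        collide : (ℓu : Labelled L u) (ℓv : Labelled L v) →
                  Labelled.a ℓu ≡ Labelled.a ℓv → Labelled.b ℓu ≡ Labelled.b ℓv → ⊥
        collide (labelled a b _ _ cu tag-u _) (labelled .a .b _ _ cv tag-v _) refl refl =
          same-colours-collide u≢v cu cv tag-u tag-v

    sees-all⇒¬PuncturedMonoCover : ∀ {v} → (∀ i → Sees φ v i) → ¬ PuncturedMonoCover v
    sees-all⇒¬PuncturedMonoCover sees (a , x , y , covers) with Sees⇒neighbour (sees a)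
    ... | w , w≢v , w↝v with covers w w≢v
    ...   | inj₁ x∋w = first-misses covers (Reach-trans x∋w w↝v)
    ...   | inj₂ y∋w = second-misses covers (Reach-trans y∋w w↝v)

some-vertex : ∀ {n r k} {φ : Colouring n r k} → ¬ CoverBy φ 0 AllV → Fin n
some-vertex {ℕ.zero}  ¬cover = ⊥-elim (¬cover ((λ ()) , λ ()))
some-vertex {suc _} _        = zero

module Critical₂ {n r k : ℕ} {φ : Colouring n r k} (k≥1 : 1 ≤ k) (critical : Critical φ 2) where

  open Components φ

  component : Fin n → Fin r × Fin n
  component v = proj₁ (proj₂ critical v) zero

  colour : Fin n → Fin r
  colour = proj₁ ∘ component

  component-covers : ∀ v w → w ≢ v → component v ∋ w
  component-covers v w w≢v with proj₂ (proj₂ critical v) w w≢v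
  ... | zero , v∋w = v∋w

  no-1-cover : ¬ CoverBy φ 1 AllV
  no-1-cover = proj₂ (proj₁ critical) 1 (ℕ.n<1+n 1)

  component-misses : ∀ v → ¬ component v ∋ v
  component-misses v = punctured-cover-misses no-1-cover (proj₂ critical v) zero

  colour-injective : Injective _≡_ _≡_ colour
  colour-injective {u} {v} same-colour with u ≟ v
  ... | yes u≡v = u≡v
  ... | no u≢v  = ⊥-elim (punctured-colours-differ k≥1 no-1-cover u≢v
                    (component-covers u) (component-misses u) (component-covers v) same-colour)

  n≤r : n ≤ r
  n≤r = injective⇒≤ colour-injective

  ¬sees-own-colour : ∀ v → ¬ Sees φ v (colour v)
  ¬sees-own-colour v sees with Sees⇒neighbour sees
  ... | w , w≢v , w↝v = component-misses v (Reach-trans (component-covers v w w≢v) w↝v)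

  ¬sees-all : ¬ (∀ v i → Sees φ v i)
  ¬sees-all sees = ¬sees-own-colour v (sees v (colour v))
    where
    v : Fin n
    v = some-vertex (proj₂ (proj₁ critical) 0 ℕ.0<1+n)

module Critical₃ {n r k : ℕ} {φ : Colouring n r k} (k≥1 : 1 ≤ k) (critical : Critical φ 3) where

  open Components φ

  no-2-cover : ¬ CoverBy φ 2 AllV
  no-2-cover = proj₂ (proj₁ critical) 2 (ℕ.n<1+n 2)

  label : ∀ v → Dec (PuncturedMonoCover v) → Labelled (colourPairs r) v
  label v (yes mono) = label-mono mono
  label v (no ¬mono) =
    relabel (xs⊆ys++xs _ _) (label-non-mono ¬mono (coverBy⇒covers₂ (proj₂ critical v)))

  -- The case split on PuncturedMonoCover is classical; it is admissible because the goal is decidable.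
  n≤r+rC2 : n ≤ r + r C 2
  n≤r+rC2 = decidable-stable (n ≤? r + r C 2)
    (¬¬-map count (sequence (RawMonad.rawApplicative ¬¬-Monad) (λ _ → ¬¬-excluded-middle)))
    where
    count : (∀ v → Dec (PuncturedMonoCover v)) → n ≤ r + r C 2
    count mono? = subst (n ≤_) (length-colourPairs r)
      (labelled-count k≥1 no-2-cover (λ v → label v (mono? v)))

  sees-all⇒n≤rC2 : (∀ v i → Sees φ v i) → n ≤ r C 2
  sees-all⇒n≤rC2 sees = subst (n ≤_) (length-ascendingPairs r)
    (labelled-count k≥1 no-2-cover λ v →
      label-non-mono (sees-all⇒¬PuncturedMonoCover k≥1 no-2-cover (sees v))
        (coverBy⇒covers₂ (proj₂ critical v)))

theorem5p2 : (n r k t : ℕ) → 1 ≤ k → k ≤ r → (t ≡ 2 ⊎ t ≡ 3) →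
    (φ : Colouring n r k) → Critical φ t →
    ((t ≡ 2 → n ≤ r) × (t ≡ 3 → n ≤ r + r C 2)) ×
    ((∀ (v : Fin n) (i : Fin r) → Sees φ v i) → t ≡ 3 × n ≤ r C 2)
theorem5p2 n r k .2 k≥1 _ (inj₁ refl) φ critical =
  ((λ _ → n≤r) , λ ()) , ⊥-elim ∘ ¬sees-all
  where open Critical₂ k≥1 critical
theorem5p2 n r k .3 k≥1 _ (inj₂ refl) φ critical =
  ((λ ()) , λ _ → n≤r+rC2) , λ sees → refl , sees-all⇒n≤rC2 sees
  where open Critical₃ k≥1 critical
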